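{- For every integer $n\ge 3$ and every integer $\ell\ge 1$, there exist $K_n$-WORM colorable graphs whose $K_n$-WORM chromatic spectrum contains a gap of size $\ell$.
   Context: All graphs are finite and simple; $K_n$ is the complete graph on $n$ vertices. For graphs $F$ and $G$, an $F$-WORM coloring of $G$ is an assignment of colors to the vertices of $G$ such that no subgraph of $G$ isomorphic to $F$ is monochromatic (all its vertices have the same color) or rainbow (its vertices have pairwise distinct colors). For an $F$-WORM colorable $G$, $W^-(G,F)$ and $W^+(G,F)$ are the minimum and maximum numbers of colors in an $F$-WORM coloring of $G$, and the $F$-WORM feasible set (chromatic spectrum) $\Phi_W(G,F)$ is the set of integers $s$ such that $G$ has an $F$-WORM coloring using exactly $s$ colors. $G$ has a gap at $k$ if $W^-(G,F)<k<W^+(G,F)$ and $k\notin\Phi_W(G,F)$; the size of a gap is the number of consecutive integers missing from $\Phi_W(G,F)$ (i.e., a gap of size $\ell$ is a maximal run of $\ell$ consecutive integers strictly between $W^-(G,F)$ and $W^+(G,F)$ none of which lies in $\Phi_W(G,F)$). -}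

module Defs where

open import Data.Nat using (ℕ; _+_; _<_)
open import Data.Fin using (Fin)
open import Data.Product using (Σ; ∃; _×_; _,_)
open import Relation.Binary.PropositionalEquality using (_≡_; _≢_)
open import Relation.Nullary using (¬_)
open import Function.Definitions using (Injective; Surjective)

record Graph : Set₁ where
  field
    order   : ℕ
    Adj     : Fin order → Fin order → Set
    symm    : ∀ {u v} → Adj u v → Adj v u
    irrefl  : ∀ {u} → ¬ Adj u u

open Graph public

record KCopy (n : ℕ) (G : Graph) : Set where
  field
    vert   : Fin n → Fin (order G)
    inj    : Injective _≡_ _≡_ vert
    adj    : ∀ i j → i ≢ j → Adj G (vert i) (vert j)

open KCopy public

Monochromatic : ∀ {n s} {G : Graph} → (Fin (order G) → Fin s) → KCopy n G → Set
Monochromatic c K = ∀ i j → c (vert K i) ≡ c (vert K j)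

Rainbow : ∀ {n s} {G : Graph} → (Fin (order G) → Fin s) → KCopy n G → Set
Rainbow c K = ∀ i j → c (vert K i) ≡ c (vert K j) → i ≡ j

IsKWorm : (n : ℕ) (G : Graph) {s : ℕ} → (Fin (order G) → Fin s) → Set
IsKWorm n G c = ∀ (K : KCopy n G) → ¬ Monochromatic c K × ¬ Rainbow c K

-- s ∈ Φ_W(G, K_n): G has a K_n-WORM colouring using exactly s colours
-- (a surjective colouring onto Fin s).
InSpectrum : (n : ℕ) (G : Graph) (s : ℕ) → Set
InSpectrum n G s = Σ (Fin (order G) → Fin s) λ c → Surjective _≡_ _≡_ c × IsKWorm n G c

KWormColorable : (n : ℕ) (G : Graph) → Set
KWormColorable n G = ∃ λ s → InSpectrum n G s

-- Φ_W(G, K_n) has a gap of size ℓ: a maximal run a+1, …, a+ℓ of missing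
-- values with a ∈ Φ and a+ℓ+1 ∈ Φ (hence strictly between W⁻ and W⁺).
HasGapOfSize : (n : ℕ) (G : Graph) (ℓ : ℕ) → Set
HasGapOfSize n G ℓ =
  ∃ λ a → InSpectrum n G a × InSpectrum n G (a + ℓ + 1)
        × (∀ j → a < j → j < a + ℓ + 1 → ¬ InSpectrum n G j)

module Submission where

-- Write n = p + 3 and N = n - 1.  The graph G(p, m), m = ℓ + 3, consists of a
-- hub W of pN vertices joined to everything, and of spokes Y_i and blocks Z_ij
-- (i, j < m) of N vertices each (module Construction).  Colouring every vertex
-- by its position inside its part uses N colours, colouring it by its part
-- uses p + m = N + ℓ + 1 colours, and both are WORM colourings because every
-- K_n contains three vertices off the hub (TwoColourings).  Conversely, in a
-- WORM colouring every clique of N² vertices has all colour classes of size 0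
-- or N (WormCliques.classes, proved by greedy extraction of rainbow cliques).
-- Applied to suitable N²-cliques (Cliques) this shows that Z_ij is coloured
-- like Z_ii, and then (Gap) either some diagonal block Z_ii is monochromatic,
-- which forces all of them to be monochromatic in distinct colours missing from
-- the hub, so p + m colours are used, or none is, and every colour occurs in
-- the N²-clique W ∪ Z_01 ∪ Z_10, so at most N colours are used.

open import Defs
open import Data.Nat using (ℕ; zero; suc; _+_; _*_; _≤_; _<_; z≤n; s≤s)
import Data.Nat.Properties as ℕ
open import Data.Nat.Tactic.RingSolver using (solve-∀)
open import Data.Fin as Fin using (Fin; zero; suc; inject≤; inject₁; fromℕ; punchIn; _↑ˡ_; _↑ʳ_)
import Data.Fin.Properties as FinP
open import Data.Sum using (_⊎_; inj₁; inj₂)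
open import Data.Sum.Function.Propositional using (_⊎-↔_)
open import Data.Product using (∃; _×_; _,_; proj₁; proj₂; uncurry)
open import Data.Product.Function.NonDependent.Propositional using (_×-↔_)
open import Data.List using (List; []; _∷_; length; filter; lookup; _++_; tabulate)
import Data.List.Properties as ListP
open import Data.List.Relation.Unary.All as All using (All; []; _∷_)
import Data.List.Relation.Unary.All.Properties as AllP
open import Data.List.Relation.Unary.AllPairs using (AllPairs; []; _∷_)
import Data.List.Relation.Unary.AllPairs.Properties as AllPairsP
open import Data.List.Relation.Unary.Any as Any using (here; there)
open import Data.List.Membership.Propositional using (_∈_)
open import Data.List.Membership.Propositional.Properties using (∈-filter⁻; ∈-lookup; ∈-tabulate⁺)
open import Data.Empty using (⊥; ⊥-elim)
open import Function using (_∘_)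
open import Function.Bundles using (_↔_; Inverse)
open import Function.Definitions using (Injective; Surjective)
open import Function.Properties.Inverse using (↔-refl; ↔-trans)
open import Relation.Nullary using (¬_; Dec; yes; no; ¬?)
open import Relation.Binary using (tri<; tri≈; tri>)
open import Relation.Binary.PropositionalEquality

module Colouring {V : Set} (_~_ : V → V → Set) where

  IsClique : ∀ {k} → (Fin k → V) → Set
  IsClique f = ∀ {a b} → a ≢ b → f a ~ f b

  IsMono : ∀ {k s} → (V → Fin s) → (Fin k → V) → Set
  IsMono χ f = ∀ a b → χ (f a) ≡ χ (f b)

  IsRainbow : ∀ {k s} → (V → Fin s) → (Fin k → V) → Set
  IsRainbow χ f = ∀ a b → χ (f a) ≡ χ (f b) → a ≡ b

  IsWorm : (n : ℕ) {s : ℕ} → (V → Fin s) → Set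
  IsWorm n χ = ∀ (f : Fin n → V) → IsClique f → ¬ IsMono χ f × ¬ IsRainbow χ f

  Onto : ∀ {s} → (V → Fin s) → Set
  Onto χ = ∀ d → ∃ λ v → χ v ≡ d

module Presentation {V : Set} (_~_ : V → V → Set)
         (~-sym : ∀ {u v} → u ~ v → v ~ u) (~-irrefl : ∀ {v} → ¬ v ~ v)
         {k : ℕ} (enum : Fin k ↔ V) where

  open Colouring _~_
  open Inverse enum using (to; from; strictlyInverseˡ; strictlyInverseʳ)

  graph : Graph
  graph = record { order = k ; Adj = λ x y → to x ~ to y ; symm = ~-sym ; irrefl = ~-irrefl }

  -- A clique of V is a copy of K_n in the graph; its vertices are distinct
  -- because adjacency is irreflexive.
  copyOf : ∀ {n} (f : Fin n → V) → IsClique f → KCopy n graph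
  copyOf f clique = record { vert = from ∘ f ; inj = injective ; adj = adjacent }
    where
    adjacent : ∀ a b → a ≢ b → to (from (f a)) ~ to (from (f b))
    adjacent a b a≢b = subst₂ _~_ (sym (strictlyInverseˡ (f a))) (sym (strictlyInverseˡ (f b))) (clique a≢b)

    injective : Injective _≡_ _≡_ (from ∘ f)
    injective {a} {b} eq with a Fin.≟ b
    ... | yes a≡b = a≡b
    ... | no a≢b = ⊥-elim (~-irrefl (subst (_~ to (from (f b))) (cong to eq) (adjacent a b a≢b)))

  restrict : ∀ {n s} {c : Fin k → Fin s} → IsKWorm n graph c → IsWorm n (c ∘ from)
  restrict worm f clique = worm (copyOf f clique)

  ontoRestrict : ∀ {s} {c : Fin k → Fin s} → Surjective _≡_ _≡_ c → Onto (c ∘ from)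
  ontoRestrict {c = c} surj d with surj d
  ... | x , cx≡d = to x , trans (cong c (strictlyInverseʳ x)) (cx≡d refl)

  fromSpectrum : ∀ {n s} → InSpectrum n graph s → ∃ λ (χ : V → Fin s) → Onto χ × IsWorm n χ
  fromSpectrum (c , surj , worm) = c ∘ from , ontoRestrict surj , restrict {c = c} worm

  inSpectrum : ∀ {n s} (χ : V → Fin s) → Onto χ → IsWorm n χ → InSpectrum n graph s
  inSpectrum χ onto worm = χ ∘ to , surjective , λ K → worm (to ∘ vert K) (adj K _ _)
    where
    surjective : Surjective _≡_ _≡_ (χ ∘ to)
    surjective d with onto d
    ... | v , χv≡d = from v , λ { refl → trans (cong χ (strictlyInverseˡ v)) χv≡d }

module Counting {V : Set} {J : ℕ} (χ : V → Fin J) where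

  ofColour : Fin J → List V → List V
  ofColour d = filter (λ v → χ v Fin.≟ d)

  notOfColour : Fin J → List V → List V
  notOfColour d = filter (λ v → ¬? (χ v Fin.≟ d))

  count : Fin J → List V → ℕ
  count d L = length (ofColour d L)

  count+rest : ∀ d L → count d L + length (notOfColour d L) ≡ length L
  count+rest d [] = refl
  count+rest d (x ∷ L) with χ x Fin.≟ d
  ... | yes _ = cong suc (count+rest d L)
  ... | no _ = trans (ℕ.+-suc (count d L) _) (cong suc (count+rest d L))

  count-++ : ∀ d xs ys → count d (xs ++ ys) ≡ count d xs + count d ys
  count-++ d xs ys = trans (cong length (ListP.filter-++ _ xs ys)) (ListP.length-++ (ofColour d xs))

  count-∷-same : ∀ {d x} L → χ x ≡ d → count d (x ∷ L) ≡ suc (count d L)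
  count-∷-same {d} L χx≡d = cong length (ListP.filter-accept (λ v → χ v Fin.≟ d) {xs = L} χx≡d)

  count-∷-other : ∀ {d x} L → χ x ≢ d → count d (x ∷ L) ≡ count d L
  count-∷-other {d} L χx≢d = cong length (ListP.filter-reject (λ v → χ v Fin.≟ d) {xs = L} χx≢d)

  count-∷-cong : ∀ {d x y L L′} → χ x ≡ χ y → count d L ≡ count d L′ → count d (x ∷ L) ≡ count d (y ∷ L′)
  count-∷-cong {d} {x} {y} {L} {L′} χx≡χy L≡L′ = byColour (χ x Fin.≟ d)
    where
    open ≡-Reasoning
    byColour : Dec (χ x ≡ d) → count d (x ∷ L) ≡ count d (y ∷ L′)
    byColour (yes χx≡d) = begin
      count d (x ∷ L)   ≡⟨ count-∷-same L χx≡d ⟩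
      suc (count d L)   ≡⟨ cong suc L≡L′ ⟩
      suc (count d L′)  ≡⟨ count-∷-same L′ (trans (sym χx≡χy) χx≡d) ⟨
      count d (y ∷ L′)  ∎
    byColour (no χx≢d) = begin
      count d (x ∷ L)   ≡⟨ count-∷-other L χx≢d ⟩
      count d L         ≡⟨ L≡L′ ⟩
      count d L′        ≡⟨ count-∷-other L′ (χx≢d ∘ trans χx≡χy) ⟨
      count d (y ∷ L′)  ∎

  count-pos : ∀ {d x L} → x ∈ L → χ x ≡ d → 0 < count d L
  count-pos x∈L χx≡d = ListP.filter-some _ (Any.map (λ { refl → χx≡d }) x∈L)

  occurs : ∀ {d} L → 0 < count d L → ∃ λ v → v ∈ L × χ v ≡ d
  occurs {d} L pos with ofColour d L in eq
  ... | [] = ⊥-elim (ℕ.n≮0 pos)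
  ... | v ∷ _ = v , ∈-filter⁻ _ (subst (v ∈_) (sym eq) (here refl))

  count-block-all : ∀ {d s} (f : Fin s → V) → (∀ k → χ (f k) ≡ d) → count d (tabulate f) ≡ s
  count-block-all f mono = trans (cong length (ListP.filter-all _ (AllP.tabulate⁺ mono))) (ListP.length-tabulate f)

  count-block-none : ∀ {d s} (f : Fin s → V) → (∀ k → χ (f k) ≢ d) → count d (tabulate f) ≡ 0
  count-block-none f avoid = cong length (ListP.filter-none _ (AllP.tabulate⁺ avoid))

  count-block-full : ∀ {d s} (f : Fin s → V) → count d (tabulate f) ≡ s → ∀ k → χ (f k) ≡ d
  count-block-full f full =
    AllP.tabulate⁻ (subst (All _) (ListP.filter-complete _ (trans full (sym (ListP.length-tabulate f))))
                                  (AllP.all-filter _ (tabulate f)))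

  count-block-cong : ∀ {d s} (f g : Fin s → V) → (∀ k → χ (f k) ≡ χ (g k)) → count d (tabulate f) ≡ count d (tabulate g)
  count-block-cong {s = zero} f g same = refl
  count-block-cong {s = suc s} f g same = count-∷-cong (same zero) (count-block-cong (f ∘ suc) (g ∘ suc) (same ∘ suc))

module WormCliques {V : Set} (_~_ : V → V → Set) (~-sym : ∀ {u v} → u ~ v → v ~ u)
         {J q : ℕ} (χ : V → Fin J) (worm : Colouring.IsWorm _~_ (suc (suc q)) χ) where

  open Colouring _~_
  open Counting χ

  private
    N : ℕ
    N = suc q

    cancel : ∀ {a b c e} → c < a → a + b ≤ c + e → b < e
    cancel {b = b} {c} {e} c<a ab≤ce = ℕ.+-cancelˡ-< c b e (ℕ.≤-trans (ℕ.+-monoˡ-≤ b c<a) ab≤ce)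

  RainbowEdge : V → V → Set
  RainbowEdge u v = u ~ v × χ u ≢ χ v

  rainbowEdge-sym : ∀ {u v} → RainbowEdge u v → RainbowEdge v u
  rainbowEdge-sym (u~v , χu≢χv) = ~-sym u~v , χu≢χv ∘ sym

  clique-adj : ∀ {L} → AllPairs _~_ L → ∀ {u v} → u ∈ L → v ∈ L → u ≢ v → u ~ v
  clique-adj (_ ∷ _) (here refl) (here refl) u≢v = ⊥-elim (u≢v refl)
  clique-adj (u~L ∷ _) (here refl) (there v∈L) _ = All.lookup u~L v∈L
  clique-adj (v~L ∷ _) (there u∈L) (here refl) _ = ~-sym (All.lookup v~L u∈L)
  clique-adj (_ ∷ clique) (there u∈L) (there v∈L) u≢v = clique-adj clique u∈L v∈L u≢v

  prefix : ∀ {k} (L : List V) → k ≤ length L → Fin k → V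
  prefix L k≤ a = lookup L (inject≤ a k≤)

  module _ {R : V → V → Set} (R-sym : ∀ {u v} → R u v → R v u) where

    pairs-lookup : ∀ {L} → AllPairs R L → ∀ {a b} → a ≢ b → R (lookup L a) (lookup L b)
    pairs-lookup (_ ∷ _) {zero} {zero} a≢b = ⊥-elim (a≢b refl)
    pairs-lookup (x~L ∷ _) {zero} {suc b} _ = All.lookup x~L (∈-lookup b)
    pairs-lookup (x~L ∷ _) {suc a} {zero} _ = R-sym (All.lookup x~L (∈-lookup a))
    pairs-lookup (_ ∷ pairs) {suc a} {suc b} a≢b = pairs-lookup pairs (a≢b ∘ cong suc)

    prefix-pairs : ∀ {k L} (k≤ : k ≤ length L) → AllPairs R L → ∀ {a b} → a ≢ b → R (prefix L k≤ a) (prefix L k≤ b)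
    prefix-pairs k≤ pairs a≢b = pairs-lookup pairs (a≢b ∘ FinP.inject≤-injective k≤ k≤ _ _)

  monoBound : ∀ {d L} → AllPairs _~_ L → All (λ v → χ v ≡ d) L → length L ≤ N
  monoBound {d} {L} clique same with length L ℕ.≤? N
  ... | yes ≤N = ≤N
  ... | no ≰N = ⊥-elim (proj₁ (worm f (prefix-pairs ~-sym n≤ clique)) mono)
    where
    n≤ = ℕ.≰⇒> ≰N
    f = prefix L n≤
    mono : IsMono χ f
    mono a b = trans (All.lookup same (∈-lookup _)) (sym (All.lookup same (∈-lookup _)))

  rainbowBound : ∀ {L} → AllPairs RainbowEdge L → length L ≤ N
  rainbowBound {L} rainbow with length L ℕ.≤? N
  ... | yes ≤N = ≤N
  ... | no ≰N = ⊥-elim (proj₂ (worm f (proj₁ ∘ edge)) distinct)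
    where
    n≤ = ℕ.≰⇒> ≰N
    f = prefix L n≤
    edge : ∀ {a b} → a ≢ b → RainbowEdge (f a) (f b)
    edge = prefix-pairs rainbowEdge-sym n≤ rainbow
    distinct : IsRainbow χ f
    distinct a b χfa≡χfb with a Fin.≟ b
    ... | yes a≡b = a≡b
    ... | no a≢b = ⊥-elim (proj₂ (edge a≢b) χfa≡χfb)

  classBound : ∀ {x L} → All (x ~_) L → AllPairs _~_ L → suc (count (χ x) L) ≤ N
  classBound {x} {L} x~L clique =
    monoBound (AllP.filter⁺ _ x~L ∷ AllPairsP.filter⁺ _ clique) (refl ∷ AllP.all-filter (λ v → χ v Fin.≟ χ x) L)

  -- Greedy extraction: a clique with more than kN vertices contains a rainbow
  -- clique on k + 1 of its vertices (keep a vertex, discard its colour class,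
  -- which has at most N vertices, and recurse).
  extract : ∀ k {L} → AllPairs _~_ L → k * N < length L →
            ∃ λ M → All (_∈ L) M × AllPairs RainbowEdge M × suc k ≤ length M
  extract zero {x ∷ L} _ _ = x ∷ [] , here refl ∷ [] , [] ∷ [] , s≤s z≤n
  extract (suc k) {x ∷ L} (x~L ∷ clique) (s≤s size)
    with extract k (AllPairsP.filter⁺ _ clique)
           (cancel (classBound x~L clique) (subst (N + k * N ≤_) (sym (count+rest (χ x) L)) size))
  ... | M , M⊆ , rainbow , long =
    x ∷ M , here refl ∷ All.map (there ∘ proj₁ ∘ ∈-filter⁻ _) M⊆ , All.map edge M⊆ ∷ rainbow , s≤s long
    where
    edge : ∀ {v} → v ∈ notOfColour (χ x) L → RainbowEdge x v
    edge v∈ with ∈-filter⁻ _ v∈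
    ... | v∈L , χv≢χx = All.lookup x~L v∈L , χv≢χx ∘ sym

  extract≤ : ∀ k {L} → AllPairs _~_ L → k * N ≤ length L →
             ∃ λ M → All (_∈ L) M × AllPairs RainbowEdge M × k ≤ length M
  extract≤ zero _ _ = [] , [] , [] , z≤n
  extract≤ (suc k) clique size = extract k clique (ℕ.<-≤-trans (ℕ.m<n+m (k * N) (s≤s z≤n)) size)

  -- In a clique of N² vertices no colour class has strictly between 0 and N
  -- vertices: otherwise the other N² - s > (N - 1)N vertices contain a rainbow
  -- clique of N vertices, which a vertex of the class extends to N + 1.
  noPartialClass : ∀ {L d} → AllPairs _~_ L → length L ≡ N * N → 0 < count d L → count d L < N → ⊥
  noPartialClass {L} {d} clique size pos c<N
    with occurs L pos
       | extract q (AllPairsP.filter⁺ _ clique)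
           (cancel c<N (ℕ.≤-reflexive (trans (sym size) (sym (count+rest d L)))))
  ... | y , y∈L , χy≡d | M , M⊆ , rainbow , long =
    ℕ.1+n≰n (ℕ.≤-trans (s≤s long) (rainbowBound (All.map edge M⊆ ∷ rainbow)))
    where
    edge : ∀ {v} → v ∈ notOfColour d L → RainbowEdge y v
    edge v∈ with ∈-filter⁻ _ v∈
    ... | v∈L , χv≢d = clique-adj clique y∈L v∈L (λ { refl → χv≢d χy≡d }) , λ χy≡χv → χv≢d (trans (sym χy≡χv) χy≡d)

  classes : ∀ {L} → AllPairs _~_ L → length L ≡ N * N → ∀ d → count d L ≡ 0 ⊎ count d L ≡ N
  classes {L} clique size d with ℕ.<-cmp (count d L) N
  ... | tri≈ _ full _ = inj₂ full
  ... | tri> _ _ N<c = ⊥-elim (ℕ.<⇒≱ N<c (monoBound (AllPairsP.filter⁺ _ clique) (AllP.all-filter _ L)))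
  ... | tri< c<N _ _ = inj₁ (ℕ.n≤0⇒n≡0 (ℕ.≮⇒≥ (λ pos → noPartialClass clique size pos c<N)))

  fewColours : ∀ {L} → AllPairs _~_ L → (∀ d → ∃ λ v → v ∈ L × χ v ≡ d) → J ≤ N
  fewColours {L} clique every with J ℕ.≤? N
  ... | yes J≤N = J≤N
  ... | no J≰N = ⊥-elim (proj₂ (worm f adjacent) distinct)
    where
    n≤J = ℕ.≰⇒> J≰N
    f : Fin (suc N) → V
    f a = proj₁ (every (inject≤ a n≤J))
    distinct : IsRainbow χ f
    distinct a b χfa≡χfb = FinP.inject≤-injective n≤J n≤J a b
      (trans (sym (proj₂ (proj₂ (every _)))) (trans χfa≡χfb (proj₂ (proj₂ (every _)))))
    adjacent : IsClique f
    adjacent a≢b = clique-adj clique (proj₁ (proj₂ (every _))) (proj₁ (proj₂ (every _))) (a≢b ∘ distinct _ _ ∘ cong χ)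

-- The graph G(p, m), for K_n-WORM colourings with n = p + 3 and N = n - 1.
-- Every part below is a clique:
--   the hub W, vertices W s k (s < p, k < N), joined to every other vertex;
--   the spokes Y_i, vertices Y i k (i < m, k < N), each joined to Z_i0 … Z_i(m-1);
--   the blocks Z_ij, vertices Z i j k (i, j < m, k < N).
module Construction (p m : ℕ) where

  N : ℕ
  N = suc (suc p)

  Vertex : Set
  Vertex = (Fin p × Fin N) ⊎ (Fin m × Fin N) ⊎ ((Fin m × Fin m) × Fin N)

  pattern W s k = inj₁ (s , k)
  pattern Y i k = inj₂ (inj₁ (i , k))
  pattern Z i j k = inj₂ (inj₂ ((i , j) , k))

  data _~_ : Vertex → Vertex → Set where
    ww : ∀ {s s′ k k′} → s ≢ s′ ⊎ k ≢ k′ → W s k ~ W s′ k′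
    wy : ∀ {s k i k′} → W s k ~ Y i k′
    yw : ∀ {s k i k′} → Y i k′ ~ W s k
    wz : ∀ {s k i j k′} → W s k ~ Z i j k′
    zw : ∀ {s k i j k′} → Z i j k′ ~ W s k
    yy : ∀ {i k k′} → k ≢ k′ → Y i k ~ Y i k′
    yz : ∀ {i j k k′} → Y i k ~ Z i j k′
    zy : ∀ {i j k k′} → Z i j k ~ Y i k′
    zz : ∀ {i j j′ k k′} → k ≢ k′ → Z i j k ~ Z i j′ k′
    zswap : ∀ {i j k k′} → i ≢ j → Z i j k ~ Z j i k′

  ~-sym : ∀ {u v} → u ~ v → v ~ u
  ~-sym (ww (inj₁ s≢s′)) = ww (inj₁ (s≢s′ ∘ sym))
  ~-sym (ww (inj₂ k≢k′)) = ww (inj₂ (k≢k′ ∘ sym))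
  ~-sym wy = yw
  ~-sym yw = wy
  ~-sym wz = zw
  ~-sym zw = wz
  ~-sym (yy k≢k′) = yy (k≢k′ ∘ sym)
  ~-sym yz = zy
  ~-sym zy = yz
  ~-sym (zz k≢k′) = zz (k≢k′ ∘ sym)
  ~-sym (zswap i≢j) = zswap (i≢j ∘ sym)

  ~-irrefl : ∀ {v} → ¬ v ~ v
  ~-irrefl (ww (inj₁ s≢s)) = s≢s refl
  ~-irrefl (ww (inj₂ k≢k)) = k≢k refl
  ~-irrefl (yy k≢k) = k≢k refl
  ~-irrefl (zz k≢k) = k≢k refl
  ~-irrefl (zswap i≢i) = i≢i refl

  size : ℕ
  size = p * N + (m * N + (m * m) * N)

  enumeration : Fin size ↔ Vertex
  enumeration = ↔-trans FinP.+↔⊎ (FinP.*↔× ⊎-↔ ↔-trans FinP.+↔⊎ (FinP.*↔× ⊎-↔ ↔-trans FinP.*↔× (FinP.*↔× ×-↔ ↔-refl)))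

  open Presentation _~_ ~-sym ~-irrefl enumeration public

  position : Vertex → Fin N
  position (W _ k) = k
  position (Y _ k) = k
  position (Z _ _ k) = k

  data OffHub : Vertex → Set where
    y : ∀ {i k} → OffHub (Y i k)
    z : ∀ {i j k} → OffHub (Z i j k)

  hub-offHub : ∀ {s k v} → OffHub v → W s k ~ v
  hub-offHub y = wy
  hub-offHub z = wz

-- Two K_n-WORM colourings of G(p, m) for m ≥ 2: by position (N colours) and
-- by "part" (p + m colours).  Both rest on the fact that p + 3 pairwise
-- adjacent vertices include three off the hub.
module TwoColourings (p m′ : ℕ) where

  m : ℕ
  m = suc (suc m′)

  open Construction p m
  open Colouring _~_

  -- The hub row of a vertex; all off-hub vertices share the extra row offHub.
  offHub : Fin (suc p)
  offHub = fromℕ p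

  row : Vertex → Fin (suc p)
  row (W s _) = inject₁ s
  row (Y _ _) = offHub
  row (Z _ _ _) = offHub

  row-offHub : ∀ {v} → OffHub v → row v ≡ offHub
  row-offHub y = refl
  row-offHub z = refl

  offHub-row : ∀ v → row v ≡ offHub → OffHub v
  offHub-row (W _ _) eq = ⊥-elim (FinP.fromℕ≢inject₁ (sym eq))
  offHub-row (Y _ _) _ = y
  offHub-row (Z _ _ _) _ = z

  SameHubRow : Vertex → Vertex → Set
  SameHubRow (W s _) (W s′ _) = s ≡ s′
  SameHubRow _ _ = ⊥

  sameRow : ∀ u v → row u ≡ row v → OffHub u ⊎ SameHubRow u v
  sameRow (W _ _) (W _ _) eq = inj₂ (FinP.inject₁-injective eq)
  sameRow (W _ _) (Y _ _) eq = ⊥-elim (FinP.fromℕ≢inject₁ (sym eq))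
  sameRow (W _ _) (Z _ _ _) eq = ⊥-elim (FinP.fromℕ≢inject₁ (sym eq))
  sameRow (Y _ _) _ _ = inj₁ y
  sameRow (Z _ _ _) _ _ = inj₁ z

  record OffHubTriple (f : Fin (3 + p) → Vertex) : Set where
    field
      a b c : Fin (3 + p)
      a≢b : a ≢ b
      b≢c : b ≢ c
      a≢c : a ≢ c
      offA : OffHub (f a)
      offB : OffHub (f b)
      offC : OffHub (f c)

  -- Among p + 3 vertices no two of which share a hub row, three are off the
  -- hub: apply the pigeonhole principle to the p + 1 rows twice.
  offHubTriple : (f : Fin (3 + p) → Vertex) → (∀ {a b} → a ≢ b → ¬ SameHubRow (f a) (f b)) → OffHubTriple f
  offHubTriple f separated
    with FinP.pigeonhole (s≤s (s≤s (ℕ.n≤1+n p))) (row ∘ f)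
  ... | a , a′ , a<a′ , ra≡ra′
    with FinP.pigeonhole (ℕ.n<1+n (suc p)) (row ∘ f ∘ punchIn a)
  ... | t , t′ , t<t′ , rt≡rt′ = record
    { a = a ; b = punchIn a t ; c = punchIn a t′
    ; a≢b = FinP.punchInᵢ≢i a t ∘ sym
    ; b≢c = FinP.<⇒≢ t<t′ ∘ FinP.punchIn-injective a t t′
    ; a≢c = FinP.punchInᵢ≢i a t′ ∘ sym
    ; offA = offA ; offB = offB
    ; offC = offHub-row (f (punchIn a t′)) (trans (sym rt≡rt′) (row-offHub offB))
    }
    where
    offRow : ∀ {a b} → a ≢ b → row (f a) ≡ row (f b) → OffHub (f a)
    offRow {a} {b} a≢b eq with sameRow (f a) (f b) eq
    ... | inj₁ off = off
    ... | inj₂ same = ⊥-elim (separated a≢b same)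
    offA : OffHub (f a)
    offA = offRow (FinP.<⇒≢ a<a′) ra≡ra′
    offB : OffHub (f (punchIn a t))
    offB = offRow (FinP.<⇒≢ t<t′ ∘ FinP.punchIn-injective a t t′) rt≡rt′

  -- Colouring by position.  A monochromatic K_n would contain three off-hub
  -- vertices at one position, and no off-hub triangle lies at one position.
  noFlatTriangle : ∀ {u v x} → OffHub u → OffHub v → OffHub x → u ~ v → v ~ x → u ~ x →
                   position u ≡ position v → position u ≡ position x → ⊥
  noFlatTriangle y y _ (yy k≢k′) _ _ uv ux = k≢k′ uv
  noFlatTriangle y z y _ _ (yy k≢k′) uv ux = k≢k′ ux
  noFlatTriangle y z z yz (zz k≢k′) yz uv ux = k≢k′ (trans (sym uv) ux)
  noFlatTriangle y z z yz (zswap i≢i) yz uv ux = i≢i refl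
  noFlatTriangle z y y _ (yy k≢k′) _ uv ux = k≢k′ (trans (sym uv) ux)
  noFlatTriangle z y z zy yz (zz k≢k′) uv ux = k≢k′ ux
  noFlatTriangle z y z zy yz (zswap i≢i) uv ux = i≢i refl
  noFlatTriangle z z y (zz k≢k′) _ _ uv ux = k≢k′ uv
  noFlatTriangle z z y (zswap i≢i) zy zy uv ux = i≢i refl
  noFlatTriangle z z z (zz k≢k′) _ _ uv ux = k≢k′ uv
  noFlatTriangle z z z (zswap _) (zz k≢k′) _ uv ux = k≢k′ (trans (sym uv) ux)
  noFlatTriangle z z z (zswap _) (zswap _) (zz k≢k′) uv ux = k≢k′ ux
  noFlatTriangle z z z (zswap i≢j) (zswap _) (zswap _) uv ux = i≢j refl

  sameHubRow-position : ∀ u v → SameHubRow u v → position u ≡ position v → u ≡ v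
  sameHubRow-position (W _ _) (W _ _) refl refl = refl

  positionWorm : IsWorm (3 + p) position
  positionWorm f clique = noMono , noRainbow
    where
    noRainbow : ¬ IsRainbow position f
    noRainbow distinct = ℕ.1+n≰n (FinP.injective⇒≤ {f = position ∘ f} (distinct _ _))

    noMono : ¬ IsMono position f
    noMono mono = flat (offHubTriple f separated)
      where
      separated : ∀ {a b} → a ≢ b → ¬ SameHubRow (f a) (f b)
      separated {a} {b} a≢b same =
        ~-irrefl (subst (f a ~_) (sym (sameHubRow-position (f a) (f b) same (mono a b))) (clique a≢b))
      flat : OffHubTriple f → ⊥
      flat t = noFlatTriangle offA offB offC (clique a≢b) (clique b≢c) (clique a≢c) (mono a b) (mono a c)
        where open OffHubTriple t

  lowSpectrum : InSpectrum (3 + p) graph N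
  lowSpectrum = inSpectrum position (λ k → Y zero k , refl) positionWorm

  next : Fin m → Fin m
  next zero = suc zero
  next (suc _) = zero

  next≢ : ∀ i → next i ≢ i
  next≢ zero ()
  next≢ (suc _) ()

  part : Vertex → Fin (p + m)
  part (W s _) = s ↑ˡ m
  part (Y i _) = p ↑ʳ next i
  part (Z i _ _) = p ↑ʳ i

  hub≢offHub : ∀ {s : Fin p} {i : Fin m} → s ↑ˡ m ≢ p ↑ʳ i
  hub≢offHub {s} {i} eq with trans (sym (FinP.splitAt-↑ˡ p s m)) (trans (cong (Fin.splitAt p) eq) (FinP.splitAt-↑ʳ p m i))
  ... | ()

  samePart-position : ∀ {u v} → u ~ v → part u ≡ part v → position u ≢ position v
  samePart-position (ww (inj₁ s≢s′)) eq _ = s≢s′ (FinP.↑ˡ-injective m _ _ eq)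
  samePart-position (ww (inj₂ k≢k′)) _ = k≢k′
  samePart-position wy eq = ⊥-elim (hub≢offHub eq)
  samePart-position yw eq = ⊥-elim (hub≢offHub (sym eq))
  samePart-position wz eq = ⊥-elim (hub≢offHub eq)
  samePart-position zw eq = ⊥-elim (hub≢offHub (sym eq))
  samePart-position (yy k≢k′) _ = k≢k′
  samePart-position {Y i _} yz eq = ⊥-elim (next≢ i (FinP.↑ʳ-injective p _ _ eq))
  samePart-position {Z i _ _} zy eq = ⊥-elim (next≢ i (FinP.↑ʳ-injective p _ _ (sym eq)))
  samePart-position (zz k≢k′) _ = k≢k′
  samePart-position (zswap i≢j) eq = ⊥-elim (i≢j (FinP.↑ʳ-injective p _ _ eq))

  noRainbowTriangle : ∀ {u v x} → OffHub u → OffHub v → OffHub x → u ~ v → v ~ x → u ~ x →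
                      part u ≢ part v → part v ≢ part x → part u ≢ part x → ⊥
  noRainbowTriangle y y _ (yy _) _ _ uv vx ux = uv refl
  noRainbowTriangle y z y _ _ (yy _) uv vx ux = ux refl
  noRainbowTriangle y z z yz _ yz uv vx ux = vx refl
  noRainbowTriangle z y y _ (yy _) _ uv vx ux = vx refl
  noRainbowTriangle z y z zy yz _ uv vx ux = ux refl
  noRainbowTriangle z z y (zz _) _ _ uv vx ux = uv refl
  noRainbowTriangle z z y (zswap i≢i) zy zy uv vx ux = i≢i refl
  noRainbowTriangle z z z (zz _) _ _ uv vx ux = uv refl
  noRainbowTriangle z z z (zswap _) (zz _) _ uv vx ux = vx refl
  noRainbowTriangle z z z (zswap _) (zswap _) _ uv vx ux = ux refl

  sameHubRow-part : ∀ u v → SameHubRow u v → part u ≡ part v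
  sameHubRow-part (W _ _) (W _ _) refl = refl

  partWorm : IsWorm (3 + p) part
  partWorm f clique = noMono , noRainbow
    where
    noMono : ¬ IsMono part f
    noMono mono = ℕ.1+n≰n (FinP.injective⇒≤ {f = position ∘ f} distinctPositions)
      where
      distinctPositions : ∀ {a b} → position (f a) ≡ position (f b) → a ≡ b
      distinctPositions {a} {b} eq with a Fin.≟ b
      ... | yes a≡b = a≡b
      ... | no a≢b = ⊥-elim (samePart-position (clique a≢b) (mono a b) eq)

    noRainbow : ¬ IsRainbow part f
    noRainbow distinct = threeParts (offHubTriple f separated)
      where
      differ : ∀ {a b} → a ≢ b → part (f a) ≢ part (f b)
      differ a≢b eq = a≢b (distinct _ _ eq)
      separated : ∀ {a b} → a ≢ b → ¬ SameHubRow (f a) (f b)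
      separated a≢b same = differ a≢b (sameHubRow-part _ _ same)
      threeParts : OffHubTriple f → ⊥
      threeParts t = noRainbowTriangle offA offB offC (clique a≢b) (clique b≢c) (clique a≢c)
                       (differ a≢b) (differ b≢c) (differ a≢c)
        where open OffHubTriple t

  partOnto : Onto part
  partOnto t with Fin.splitAt p t in eq
  ... | inj₁ s = W s zero , trans (cong (Fin.join p m) (sym eq)) (FinP.join-splitAt p m t)
  ... | inj₂ i = Z i i zero , trans (cong (Fin.join p m) (sym eq)) (FinP.join-splitAt p m t)

  highSpectrum : InSpectrum (3 + p) graph (p + m)
  highSpectrum = inSpectrum part partOnto partWorm

module Cliques (p m : ℕ) where

  open Construction p m

  hubVertex : Fin (p * N) → Vertex
  hubVertex = inj₁ ∘ Fin.remQuot N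

  hub : List Vertex
  hub = tabulate hubVertex

  block : Fin m → Fin m → List Vertex
  block i j = tabulate (Z i j)

  spoke : Fin m → List Vertex
  spoke i = tabulate (Y i)

  blockWithout : Fin m → Fin N → List Vertex
  blockWithout i k = tabulate (Z i i ∘ punchIn k)

  pair : Fin m → Fin m → List Vertex
  pair i j = hub ++ block i j ++ block j i

  home : Fin m → List Vertex
  home i = hub ++ block i i ++ spoke i

  exchange : Fin m → Fin N → List Vertex
  exchange i k = hub ++ spoke i ++ blockWithout i k

  hubClique : AllPairs _~_ hub
  hubClique = AllPairsP.tabulate⁺ (λ t≢t′ → distinct (t≢t′ ∘ remQuot-injective))
    where
    remQuot-injective : ∀ {t t′} → Fin.remQuot {p} N t ≡ Fin.remQuot N t′ → t ≡ t′
    remQuot-injective {t} {t′} eq =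
      trans (sym (FinP.combine-remQuot {p} N t)) (trans (cong (uncurry Fin.combine) eq) (FinP.combine-remQuot {p} N t′))
    distinct : ∀ {x x′ : Fin p × Fin N} → x ≢ x′ → inj₁ x ~ inj₁ x′
    distinct {s , k} {s′ , k′} x≢x′ with s Fin.≟ s′ | k Fin.≟ k′
    ... | no s≢s′ | _ = ww (inj₁ s≢s′)
    ... | yes _ | no k≢k′ = ww (inj₂ k≢k′)
    ... | yes refl | yes refl = ⊥-elim (x≢x′ refl)

  withHub : ∀ {L} → All OffHub L → AllPairs _~_ L → AllPairs _~_ (hub ++ L)
  withHub offL clique = AllPairsP.++⁺ hubClique clique (AllP.tabulate⁺ {f = hubVertex} (λ _ → All.map hub-offHub offL))

  block-offHub : ∀ i j → All OffHub (block i j)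
  block-offHub i j = AllP.tabulate⁺ {f = Z i j} (λ _ → z)

  blockClique : ∀ i j → AllPairs _~_ (block i j)
  blockClique i j = AllPairsP.tabulate⁺ (zz {j′ = j})

  pairClique : ∀ {i j} → i ≢ j → AllPairs _~_ (pair i j)
  pairClique {i} {j} i≢j =
    withHub (AllP.++⁺ (block-offHub i j) (block-offHub j i))
            (AllPairsP.++⁺ (blockClique i j) (blockClique j i) (AllP.tabulate⁺ {f = Z i j} (λ _ → AllP.tabulate⁺ {f = Z j i} (λ _ → zswap i≢j))))

  homeClique : ∀ i → AllPairs _~_ (home i)
  homeClique i =
    withHub (AllP.++⁺ (block-offHub i i) (AllP.tabulate⁺ {f = Y i} (λ _ → y)))
            (AllPairsP.++⁺ (blockClique i i) (AllPairsP.tabulate⁺ yy) (AllP.tabulate⁺ {f = Z i i} (λ _ → AllP.tabulate⁺ {f = Y i} (λ _ → zy))))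

  exchangeClique : ∀ i j k → AllPairs _~_ (Z i j k ∷ exchange i k)
  exchangeClique i j k =
    head ∷ withHub (AllP.++⁺ (AllP.tabulate⁺ {f = Y i} (λ _ → y)) (AllP.tabulate⁺ {f = Z i i ∘ punchIn k} (λ _ → z))) rest
    where
    rest : AllPairs _~_ (spoke i ++ blockWithout i k)
    rest = AllPairsP.++⁺ (AllPairsP.tabulate⁺ yy)
                         (AllPairsP.tabulate⁺ (λ t≢t′ → zz {j′ = i} (t≢t′ ∘ FinP.punchIn-injective k _ _)))
                         (AllP.tabulate⁺ {f = Y i} (λ _ → AllP.tabulate⁺ {f = Z i i ∘ punchIn k} (λ _ → yz)))
    head : All (Z i j k ~_) (exchange i k)
    head = AllP.++⁺ (AllP.tabulate⁺ {f = hubVertex} (λ _ → zw))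
             (AllP.++⁺ (AllP.tabulate⁺ {f = Y i} (λ _ → zy))
                       (AllP.tabulate⁺ {f = Z i i ∘ punchIn k} (λ t → zz (FinP.punchInᵢ≢i k t ∘ sym))))

  length-hub++ : ∀ xs ys → length (hub ++ xs ++ ys) ≡ p * N + (length xs + length ys)
  length-hub++ xs ys = trans (ListP.length-++ hub) (cong₂ _+_ (ListP.length-tabulate hubVertex) (ListP.length-++ xs))

  twoBlocksLength : (f g : Fin N → Vertex) → length (hub ++ tabulate f ++ tabulate g) ≡ N * N
  twoBlocksLength f g = begin
    length (hub ++ tabulate f ++ tabulate g)                ≡⟨ length-hub++ (tabulate f) (tabulate g) ⟩
    p * N + (length (tabulate f) + length (tabulate g))     ≡⟨ cong₂ (λ a b → p * N + (a + b)) {y = N} {v = N}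
                                                                  (ListP.length-tabulate f) (ListP.length-tabulate g) ⟩
    p * N + (N + N)                                         ≡⟨ square p ⟨
    N * N                                                   ∎
    where
    open ≡-Reasoning
    square : ∀ p → (2 + p) * (2 + p) ≡ p * (2 + p) + ((2 + p) + (2 + p))
    square = solve-∀

  exchangeLength : ∀ i j k → length (Z i j k ∷ exchange i k) ≡ N * N
  exchangeLength i j k = begin
    suc (length (exchange i k))                                        ≡⟨ cong suc (length-hub++ (spoke i) (blockWithout i k)) ⟩
    suc (p * N + (length (spoke i) + length (blockWithout i k)))       ≡⟨ cong₂ (λ a b → suc (p * N + (a + b))) {y = N} {v = suc p}
                                                                            (ListP.length-tabulate (Y i))
                                                                            (ListP.length-tabulate (Z i i ∘ punchIn k)) ⟩
    suc (p * N + (N + suc p))                                          ≡⟨ square p ⟨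
    N * N                                                              ∎
    where
    open ≡-Reasoning
    square : ∀ p → (2 + p) * (2 + p) ≡ suc (p * (2 + p) + ((2 + p) + suc p))
    square = solve-∀

module Gap (p r : ℕ) {J : ℕ} (χ : Construction.Vertex p (3 + r) → Fin J)
           (worm : Colouring.IsWorm (Construction._~_ p (3 + r)) (3 + p) χ) where

  m : ℕ
  m = 3 + r

  open Construction p m
  open Cliques p m
  open Colouring _~_ using (Onto)
  open Counting χ
  open WormCliques _~_ ~-sym χ worm

  ZeroOrN : ℕ → Set
  ZeroOrN x = x ≡ 0 ⊎ x ≡ N

  private
    swap : ∀ x u b → x + (u + b) ≡ u + (x + b)
    swap = solve-∀

  aboveN : ∀ b → ZeroOrN (N + b) → b ≡ 0
  aboveN b (inj₂ full) = ℕ.+-cancelˡ-≡ N b 0 (trans full (sym (ℕ.+-identityʳ N)))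

  besideFull : ∀ x b → ZeroOrN (x + (N + b)) → x ≡ 0 × b ≡ 0
  besideFull x b total = ℕ.m+n≡0⇒m≡0 x rest , ℕ.m+n≡0⇒n≡0 x rest
    where
    rest : x + b ≡ 0
    rest = aboveN (x + b) (subst ZeroOrN (swap x N b) total)

  complementZero : ∀ x u b → ZeroOrN (x + (u + b)) → x + u ≡ N → b ≡ 0
  complementZero x u b total xu≡N = aboveN b (subst ZeroOrN (trans (sym (ℕ.+-assoc x u b)) (cong (_+ b) xu≡N)) total)

  pos≢0 : ∀ {x} → 0 < x → x ≢ 0
  pos≢0 pos x≡0 = ℕ.n≮0 (subst (0 <_) x≡0 pos)

  positiveIsN : ∀ {x} → 0 < x → ZeroOrN x → x ≡ N
  positiveIsN pos (inj₁ refl) = ⊥-elim (ℕ.n≮0 pos)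
  positiveIsN _ (inj₂ full) = full

  almostFull : ∀ {c} → ZeroOrN (suc c) → c ≡ suc p
  almostFull (inj₂ full) = ℕ.suc-injective full

  notAlmostFull : ¬ ZeroOrN (suc p)
  notAlmostFull (inj₂ full) = ℕ.1+n≢n (sym full)

  -- In the N²-cliques
  -- Z i i k ∷ R and Z i j k ∷ R, R = exchange i k, the colour d = χ (Z i i k)
  -- has a class of size 0 or N; the first clique forces d to have N - 1
  -- vertices in R, so the second needs Z i j k to have colour d as well.
  blockColour : ∀ i j k → χ (Z i j k) ≡ χ (Z i i k)
  blockColour i j k with χ (Z i j k) Fin.≟ χ (Z i i k)
  ... | yes same = same
  ... | no differ = ⊥-elim (notAlmostFull (subst ZeroOrN (trans (count-∷-other R differ) inR) second))
    where
    d = χ (Z i i k)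
    R = exchange i k
    inR : count d R ≡ suc p
    inR = almostFull (subst ZeroOrN (count-∷-same R refl) (classes (exchangeClique i i k) (exchangeLength i i k) d))
    second : ZeroOrN (count d (Z i j k ∷ R))
    second = classes (exchangeClique i j k) (exchangeLength i j k) d

  onHub : Fin J → ℕ
  onHub d = count d hub

  onBlock : Fin m → Fin J → ℕ
  onBlock i d = count d (block i i)

  onSpoke : Fin m → Fin J → ℕ
  onSpoke i d = count d (spoke i)

  count-hub++ : ∀ d xs ys → count d (hub ++ xs ++ ys) ≡ onHub d + (count d xs + count d ys)
  count-hub++ d xs ys = trans (count-++ d hub _) (cong (onHub d +_) (count-++ d xs ys))

  pairCounts : ∀ i j d → count d (pair i j) ≡ onHub d + (onBlock i d + onBlock j d)
  pairCounts i j d =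
    trans (count-hub++ d (block i j) (block j i))
          (cong₂ (λ a b → onHub d + (a + b)) (count-block-cong (Z i j) (Z i i) (blockColour i j))
                                             (count-block-cong (Z j i) (Z j j) (blockColour j i)))

  pairCount : ∀ {i j} → i ≢ j → ∀ d → ZeroOrN (onHub d + (onBlock i d + onBlock j d))
  pairCount {i} {j} i≢j d = subst ZeroOrN (pairCounts i j d) (classes (pairClique i≢j) (twoBlocksLength (Z i j) (Z j i)) d)

  homeCount : ∀ i d → ZeroOrN (onHub d + (onBlock i d + onSpoke i d))
  homeCount i d = subst ZeroOrN (count-hub++ d (block i i) (spoke i)) (classes (homeClique i) (twoBlocksLength (Z i i) (Y i)) d)

  col : Fin m → Fin J
  col i = χ (Z i i zero)

  MonoBlock : Fin m → Set
  MonoBlock i = ∀ k → χ (Z i i k) ≡ col i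

  monoBlock-full : ∀ {i} → MonoBlock i → onBlock i (col i) ≡ N
  monoBlock-full {i} mono = count-block-all (Z i i) mono

  full-monoBlock : ∀ {i d} → onBlock i d ≡ N → MonoBlock i
  full-monoBlock {i} full k = trans (count-block-full (Z i i) full k) (sym (count-block-full (Z i i) full zero))

  onBlock-pos : ∀ i k → 0 < onBlock i (χ (Z i i k))
  onBlock-pos i k = count-pos (∈-tabulate⁺ {f = Z i i} k) refl

  otherThan : ∀ (i : Fin m) → ∃ λ j → j ≢ i
  otherThan zero = suc zero , λ ()
  otherThan (suc _) = zero , λ ()

  otherThanBoth : ∀ (i j : Fin m) → ∃ λ k → k ≢ i × k ≢ j
  otherThanBoth i j with zero Fin.≟ i | zero Fin.≟ j
  ... | no 0≢i | no 0≢j = zero , 0≢i , 0≢j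
  ... | yes refl | _ with suc zero Fin.≟ j
  ...   | no 1≢j = suc zero , (λ ()) , 1≢j
  ...   | yes refl = suc (suc zero) , (λ ()) , (λ ())
  otherThanBoth i j | no _ | yes refl with suc zero Fin.≟ i
  ...   | no 1≢i = suc zero , 1≢i , (λ ())
  ...   | yes refl = suc (suc zero) , (λ ()) , (λ ())

  -- Case A: some diagonal block is monochromatic.  Then all are, in pairwise
  -- different colours that avoid the hub; the hub (pN vertices) shows p further
  -- colours, so at least p + m colours are used.
  module MonochromaticBlock (i₀ : Fin m) (mono₀ : MonoBlock i₀) where

    -- any other Z_jj is monochromatic, in colour e = col j: the pair cliques
    -- with i₀ and with a third index k place all N vertices of colour e on Z_jj
    spread : ∀ j → j ≢ i₀ → MonoBlock j
    spread j j≢i₀ = full-monoBlock {j} {e} onBlock-j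
      where
      d₀ = col i₀
      e = col j
      k = proj₁ (otherThanBoth i₀ j)
      k≢i₀ = proj₁ (proj₂ (otherThanBoth i₀ j))
      k≢j = proj₂ (proj₂ (otherThanBoth i₀ j))

      -- Z_jj misses d₀, as Z_i₀i₀ already has N vertices of that colour
      j-misses-d₀ : onBlock j d₀ ≡ 0
      j-misses-d₀ = proj₂ (besideFull (onHub d₀) (onBlock j d₀)
        (subst (λ t → ZeroOrN (onHub d₀ + (t + onBlock j d₀))) (monoBlock-full mono₀) (pairCount (j≢i₀ ∘ sym) d₀)))

      i₀-misses-e : onBlock i₀ e ≡ 0
      i₀-misses-e = count-block-none (Z i₀ i₀) (λ t χ≡e →
        pos≢0 (subst (λ c → 0 < onBlock j c) (trans (sym χ≡e) (mono₀ t)) (onBlock-pos j zero)) j-misses-d₀)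

      -- the hub and Z_jj together hold N vertices of colour e ...
      hub+j : onHub e + onBlock j e ≡ N
      hub+j = positiveIsN (ℕ.≤-trans (onBlock-pos j zero) (ℕ.m≤n+m _ (onHub e)))
        (subst (λ t → ZeroOrN (onHub e + (t + onBlock j e))) i₀-misses-e (pairCount (j≢i₀ ∘ sym) e))

      -- ... so Z_kk misses e, and the pair i₀ k shows that the hub has 0 or N of them
      hub-e : ZeroOrN (onHub e)
      hub-e = subst ZeroOrN (trans (cong₂ (λ a b → onHub e + (a + b)) i₀-misses-e
                                      (complementZero (onHub e) (onBlock j e) (onBlock k e) (pairCount (k≢j ∘ sym) e) hub+j))
                                   (ℕ.+-identityʳ (onHub e)))
                    (pairCount (k≢i₀ ∘ sym) e)

      onBlock-j : onBlock j e ≡ N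
      onBlock-j with hub-e
      ... | inj₁ none = trans (cong (_+ onBlock j e) (sym none)) hub+j
      ... | inj₂ full =
        ⊥-elim (pos≢0 (onBlock-pos j zero) (aboveN (onBlock j e) (inj₂ (trans (cong (_+ onBlock j e) (sym full)) hub+j))))

    allMono : ∀ j → MonoBlock j
    allMono j with j Fin.≟ i₀
    ... | yes refl = mono₀
    ... | no j≢i₀ = spread j j≢i₀

    -- colour col i has N vertices on Z_ii, so none on the hub or on any other Z_jj
    besideMono : ∀ {i j} → i ≢ j → onHub (col i) ≡ 0 × onBlock j (col i) ≡ 0
    besideMono {i} {j} i≢j = besideFull (onHub (col i)) (onBlock j (col i))
      (subst (λ t → ZeroOrN (onHub (col i) + (t + onBlock j (col i)))) (monoBlock-full (allMono i)) (pairCount i≢j (col i)))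

    distinctColours : ∀ {i j} → i ≢ j → col i ≢ col j
    distinctColours {i} {j} i≢j same = ℕ.1+n≢0 (trans (sym (monoBlock-full (allMono j)))
                                                      (trans (cong (onBlock j) (sym same)) (proj₂ (besideMono i≢j))))

    hubMisses : ∀ j → onHub (col j) ≡ 0
    hubMisses j = proj₁ (besideMono (proj₂ (otherThan j) ∘ sym))

    -- the hub contains a rainbow set of p vertices (extract≤); their colours
    -- and the m block colours are pairwise distinct
    manyColours : p + m ≤ J
    manyColours with extract≤ p hubClique (ℕ.≤-reflexive (sym (ListP.length-tabulate hubVertex)))
    ... | M , M⊆hub , rainbow , p≤ = FinP.injective⇒≤ {f = colour ∘ Fin.splitAt p} (splitAt-injective ∘ colour-injective _ _)
      where
      hubColour : Fin p → Fin J
      hubColour s = χ (prefix M p≤ s)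

      colour : Fin p ⊎ Fin m → Fin J
      colour (inj₁ s) = hubColour s
      colour (inj₂ i) = col i

      hubColour≢col : ∀ s j → hubColour s ≢ col j
      hubColour≢col s j same = pos≢0 (count-pos (All.lookup M⊆hub (∈-lookup _)) same) (hubMisses j)

      colour-injective : ∀ u v → colour u ≡ colour v → u ≡ v
      colour-injective (inj₁ s) (inj₁ s′) same with s Fin.≟ s′
      ... | yes refl = refl
      ... | no s≢s′ = ⊥-elim (proj₂ (prefix-pairs rainbowEdge-sym p≤ rainbow s≢s′) same)
      colour-injective (inj₂ i) (inj₂ j) same with i Fin.≟ j
      ... | yes refl = refl
      ... | no i≢j = ⊥-elim (distinctColours i≢j same)
      colour-injective (inj₁ s) (inj₂ j) same = ⊥-elim (hubColour≢col s j same)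
      colour-injective (inj₂ i) (inj₁ s) same = ⊥-elim (hubColour≢col s i (sym same))

      splitAt-injective : ∀ {x x′} → Fin.splitAt p x ≡ Fin.splitAt p x′ → x ≡ x′
      splitAt-injective {x} {x′} eq =
        trans (sym (FinP.join-splitAt p m x)) (trans (cong (Fin.join p m) eq) (FinP.join-splitAt p m x′))

  -- Case B: no diagonal block is monochromatic.  Then every colour in use
  -- occurs in the N²-clique pair 0 1, so at most N colours are used.
  module NoMonochromaticBlock (noMono : ∀ i → ¬ MonoBlock i) where

    notFull : ∀ i d → onBlock i d ≢ N
    notFull i d full = noMono i (full-monoBlock full)

    Q : List Vertex
    Q = pair zero (suc zero)

    missing : ∀ {e} → count e Q ≡ 0 → onHub e ≡ 0 × (∀ i → onBlock i e ≡ 0)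
    missing {e} none = hub-e , blocks
      where
      inQ : onHub e + (onBlock zero e + onBlock (suc zero) e) ≡ 0
      inQ = trans (sym (pairCounts zero (suc zero) e)) none
      hub-e : onHub e ≡ 0
      hub-e = ℕ.m+n≡0⇒m≡0 (onHub e) inQ
      block₀ : onBlock zero e ≡ 0
      block₀ = ℕ.m+n≡0⇒m≡0 (onBlock zero e) (ℕ.m+n≡0⇒n≡0 (onHub e) inQ)
      blocks : ∀ i → onBlock i e ≡ 0
      blocks zero = block₀
      blocks (suc i) with subst ZeroOrN (cong₂ (λ a b → a + (b + onBlock (suc i) e)) hub-e block₀) (pairCount {zero} {suc i} (λ ()) e)
      ... | inj₁ none′ = none′
      ... | inj₂ full = ⊥-elim (notFull (suc i) e full)

    -- for j ≠ i, the hub and Z_ii together cannot hold 0 or N vertices of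
    -- colour col j: with Z_jj, which holds some but not N of them, they form
    -- the clique pair i j
    colourSplits : ∀ {i j} → i ≢ j → ¬ ZeroOrN (onHub (col j) + onBlock i (col j))
    colourSplits {i} {j} i≢j (inj₂ full) =
      pos≢0 (onBlock-pos j zero) (complementZero (onHub (col j)) (onBlock i (col j)) (onBlock j (col j)) (pairCount i≢j (col j)) full)
    colourSplits {i} {j} i≢j (inj₁ empty) =
      notFull j (col j) (positiveIsN (onBlock-pos j zero)
        (subst ZeroOrN (trans (sym (ℕ.+-assoc (onHub (col j)) (onBlock i (col j)) (onBlock j (col j))))
                              (cong (_+ onBlock j (col j)) empty))
                       (pairCount i≢j (col j))))

    -- a colour missing from Q misses every spoke too: a spoke Y_i of colour e
    -- would be entirely of colour e, so the home clique of i would make the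
    -- colour col j (j ≠ i, col j ≠ e) not split between the hub and Z_ii
    spokeMisses : ∀ {e} → count e Q ≡ 0 → ∀ i k → χ (Y i k) ≢ e
    spokeMisses {e} none i k χ≡e = colourSplits (proj₂ (otherThan i) ∘ sym) (subst ZeroOrN home-g (homeCount i g))
      where
      j = proj₁ (otherThan i)
      g = col j
      spoke-full : onSpoke i e ≡ N
      spoke-full = positiveIsN (count-pos (∈-tabulate⁺ {f = Y i} k) χ≡e)
        (subst ZeroOrN (cong₂ (λ a b → a + (b + onSpoke i e)) (proj₁ (missing none)) (proj₂ (missing none) i)) (homeCount i e))
      g≢e : g ≢ e
      g≢e g≡e = pos≢0 (subst (λ c → 0 < onBlock j c) g≡e (onBlock-pos j zero)) (proj₂ (missing none) j)
      spoke-g : onSpoke i g ≡ 0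
      spoke-g = count-block-none (Y i) (λ t χ≡g → g≢e (trans (sym χ≡g) (count-block-full (Y i) spoke-full t)))
      home-g : onHub g + (onBlock i g + onSpoke i g) ≡ onHub g + onBlock i g
      home-g = cong (onHub g +_) (trans (cong (onBlock i g +_) spoke-g) (ℕ.+-identityʳ (onBlock i g)))

    inQ : ∀ v → 0 < count (χ v) Q
    inQ v with count (χ v) Q ℕ.≟ 0
    ... | no nonzero = ℕ.n≢0⇒n>0 nonzero
    ... | yes none = ⊥-elim (absent v refl)
      where
      absent : ∀ u → χ u ≡ χ v → ⊥
      absent (W s k) same = pos≢0 (count-pos onHub-member same) (proj₁ (missing none))
        where
        onHub-member : W s k ∈ hub
        onHub-member = subst (_∈ hub) (cong inj₁ (FinP.remQuot-combine s k)) (∈-tabulate⁺ {f = hubVertex} (Fin.combine s k))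
      absent (Y i k) same = spokeMisses none i k same
      absent (Z i j k) same =
        pos≢0 (subst (λ c → 0 < onBlock i c) (trans (sym (blockColour i j k)) same) (onBlock-pos i k)) (proj₂ (missing none) i)

    fewColoursUsed : Onto χ → J ≤ N
    fewColoursUsed onto = fewColours (pairClique {zero} {suc zero} (λ ())) every
      where
      every : ∀ d → ∃ λ v → v ∈ Q × χ v ≡ d
      every d with onto d
      ... | v , refl = occurs Q (inQ v)

  gap : Onto χ → J ≤ N ⊎ p + m ≤ J
  gap onto with FinP.any? (λ i → FinP.all? (λ k → χ (Z i i k) Fin.≟ col i))
  ... | yes (i₀ , mono₀) = inj₂ (MonochromaticBlock.manyColours i₀ mono₀)
  ... | no none = inj₁ (NoMonochromaticBlock.fewColoursUsed (λ i mono → none (i , mono)) onto)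

-- For n = p + 3, the spectrum of G(p, ℓ + 3) contains N = p + 2 and
-- p + ℓ + 3 = N + ℓ + 1 but nothing strictly in between (the argument does
-- not need ℓ ≥ 1).
theorem4 : ∀ (n ℓ : ℕ) → 3 ≤ n → 1 ≤ ℓ →
    ∃ λ (G : Graph) → KWormColorable n G × HasGapOfSize n G ℓ
theorem4 (suc (suc (suc p))) ℓ (s≤s (s≤s (s≤s _))) _ =
  graph , (N , lowSpectrum) , N , lowSpectrum , top , noneBetween
  where
  open Construction p (3 + ℓ)
  open TwoColourings p (suc ℓ) using (lowSpectrum; highSpectrum)

  sizes : p + (3 + ℓ) ≡ N + ℓ + 1
  sizes = rearrange p ℓ
    where
    rearrange : ∀ p ℓ → p + (3 + ℓ) ≡ (2 + p) + ℓ + 1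
    rearrange = solve-∀

  top : InSpectrum (3 + p) graph (N + ℓ + 1)
  top = subst (InSpectrum (3 + p) graph) sizes highSpectrum

  noneBetween : ∀ j → N < j → j < N + ℓ + 1 → ¬ InSpectrum (3 + p) graph j
  noneBetween j N<j j<top inΦ with fromSpectrum inΦ
  ... | χ , onto , worm with Gap.gap p ℓ χ worm onto
  ...   | inj₁ j≤N = ℕ.<⇒≱ N<j j≤N
  ...   | inj₂ p+m≤j = ℕ.<⇒≱ j<top (subst (_≤ j) sizes p+m≤j)
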